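{- Let $k \in \mathbb{N}$, let $G$ be a digraph and $\mathcal{P}_{k}=\{V_{ij}:i,j\in [k]\}$ a $k^2$-partition of $V(G)$. Let $\mathcal{Q}$ be a path system all of whose edges lie in $\mathcal{B}_{k}(\mathcal{P}_{k},G)$ such that for all $i \in [k]$, $\sum_{j\neq i}a_{ij}-\sum_{j\neq i}a_{ji}=|V_{i*}|-|V_{*i}|$, where $a_{ij}=|E(\mathcal{Q})\cap E(V_{i*},V_{*j})|$ for $i\neq j$. Then contracting $\mathcal{Q}$ in $G$ with respect to $\mathcal{P}_{k}$ yields a digraph $G'$ with a $k^2$-partition $\mathcal{P}'_{k}=\{V'_{ij}:i,j \in [k]\}$ such that $|V_{i*}'|=|V_{*i}'|$ for all $i \in [k]$.
   Context: A digraph is a finite directed graph without loops, with at most one edge from $a$ to $b$ for each ordered pair of distinct vertices. A path system is a set of vertex-disjoint directed paths. A $k^2$-partition is a partition $\{V_{ij}:i,j\in[k]\}$ of $V(G)$ (parts may be empty); $V_{i*}=\bigcup_j V_{ij}$, $V_{*j}=\bigcup_i V_{ij}$; $E(A,B)$ is the set of edges $ab$ with $a\in A,b\in B$; $\mathcal{B}_k(\mathcal{P}_k,G)=\bigcup_{i\neq j}E(V_{i*},V_{*j})$. Contraction of $\mathcal{Q}$ with respect to $\mathcal{P}_k$: for each path $Q\in\mathcal{Q}$ from $u$ to $v$, create a new vertex $x_Q$ whose inneighbours are those of $u$ and outneighbours those of $v$ (vertices of other contracted paths being represented by their new vertices); if $u\in V_{ij}$ and $v\in V_{i'j'}$, put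 $x_Q$ into $V_{i'j}$; then delete all vertices of the paths of $\mathcal{Q}$. The updated parts are $V'_{ij}$ and the resulting digraph is $G'$. -}

module Defs where

open import Data.Nat using (ℕ; _+_)
open import Data.Fin using (Fin; splitAt; _≟_)
open import Data.Integer using (ℤ; +_; _-_)
open import Data.List using (List; []; _∷_; length; filter; map; concatMap; lookup; allFin)
open import Data.Nat.ListAction using (sum)
open import Data.List.NonEmpty using (List⁺; head; last; toList)
open import Data.List.Relation.Unary.All using (All)
open import Data.List.Relation.Unary.Unique.Propositional using (Unique)
open import Data.List.Membership.Propositional using (_∉_)
open import Data.Product using (_×_; _,_; proj₁; proj₂)
open import Data.Sum using (_⊎_; inj₁; inj₂)
open import Relation.Binary.PropositionalEquality using (_≡_; _≢_)
open import Relation.Nullary using (¬_; ¬?)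
open import Relation.Nullary.Decidable using (Dec; _×-dec_)
open import Level using (0ℓ) renaming (suc to lsuc)

-- A digraph on the vertex set Fin n: an adjacency relation without loops.
-- (At most one edge per ordered pair is automatic for a relation.)
record Digraph : Set₁ where
  field
    n    : ℕ
    _⇒_  : Fin n → Fin n → Set
    loopless : ∀ v → ¬ (v ⇒ v)
open Digraph public

Partition : ℕ → ℕ → Set
Partition k n = Fin n → Fin k × Fin k

countL : ∀ {A : Set} {P : A → Set} → (∀ x → Dec (P x)) → List A → ℕ
countL P? xs = length (filter P? xs)

rowSize : ∀ {k n} → Partition k n → Fin k → ℕ
rowSize {n = n} part i = countL (λ v → proj₁ (part v) ≟ i) (allFin n)

colSize : ∀ {k n} → Partition k n → Fin k → ℕ
colSize {n = n} part i = countL (λ v → proj₂ (part v) ≟ i) (allFin n)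

pairs : ∀ {A : Set} → List A → List (A × A)
pairs []           = []
pairs (x ∷ [])     = []
pairs (x ∷ y ∷ xs) = (x , y) ∷ pairs (y ∷ xs)

-- A path system: a list of (nonempty) directed paths, given by their vertex
-- sequences, pairwise vertex-disjoint and each without repeated vertices.
vertsOf : ∀ {n} → List (List⁺ (Fin n)) → List (Fin n)
vertsOf = concatMap toList

edgesOf : ∀ {n} → List (List⁺ (Fin n)) → List (Fin n × Fin n)
edgesOf = concatMap (λ Q → pairs (toList Q))

record PathSystem (G : Digraph) : Set where
  field
    paths    : List (List⁺ (Fin (n G)))
    disjoint : Unique (vertsOf paths)
    isPath   : All (λ Q → All (λ e → _⇒_ G (proj₁ e) (proj₂ e)) (pairs (toList Q))) paths
open PathSystem public

-- edge ab lies in B_k(P_k,G) = ⋃_{i≠j} E(V_{i*},V_{*j})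
InB : ∀ {k n} → Partition k n → Fin n × Fin n → Set
InB part (a , b) = proj₁ (part a) ≢ proj₂ (part b)

aCount : ∀ {k n} → Partition k n → List (List⁺ (Fin n)) → Fin k → Fin k → ℕ
aCount part Qs i j =
  countL (λ e → (proj₁ (part (proj₁ e)) ≟ i) ×-dec (proj₂ (part (proj₂ e)) ≟ j)) (edgesOf Qs)

sumNeq : ∀ {k} → Fin k → (Fin k → ℕ) → ℕ
sumNeq {k} i f = sum (map f (filter (λ j → ¬? (j ≟ i)) (allFin k)))

module Contraction {k : ℕ} (G : Digraph) (part : Partition k (n G)) (Qs : List (List⁺ (Fin (n G)))) where

  open import Data.List.Membership.DecPropositional (_≟_ {n G}) using (_∈?_)

  untouched : List (Fin (n G))
  untouched = filter (λ v → ¬? (v ∈? vertsOf Qs)) (allFin (n G))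

  u p : ℕ
  u = length untouched
  p = length Qs

  -- vertices of G': the untouched vertices, followed by one new vertex x_Q per path Q
  V' : Set
  V' = Fin (u + p)

  classify : V' → Fin u ⊎ Fin p
  classify = splitAt u

  -- vertex of G whose inneighbours are those of x (u for x_Q, the vertex itself otherwise)
  inRep : V' → Fin (n G)
  inRep x with classify x
  ... | inj₁ w = lookup untouched w
  ... | inj₂ q = head (lookup Qs q)

  -- vertex of G whose outneighbours are those of x (v for x_Q, the vertex itself otherwise)
  outRep : V' → Fin (n G)
  outRep x with classify x
  ... | inj₁ w = lookup untouched w
  ... | inj₂ q = last (lookup Qs q)

  G' : Digraph
  G' = record
    { n = u + p
    ; _⇒_ = λ x y → (x ≢ y) × _⇒_ G (outRep x) (inRep y)
    ; loopless = λ v e → proj₁ e _≡_.refl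
    }

  part' : Partition k (u + p)
  part' x with classify x
  ... | inj₁ w = part (lookup untouched w)
  ... | inj₂ q = proj₁ (part (last (lookup Qs q))) , proj₂ (part (head (lookup Qs q)))

-- Contraction deletes the vertices of the paths and adds, per path Q,
-- one vertex in the row of the last vertex of Q.  Every other vertex of Q is the source of exactly
-- one edge of Q, so the row count drops by the number of edges of Q with source in row i; as these
-- edges lie in B_k, that number is Σ_{j≠i} a_ij.  Dually (first vertices, edge targets) the column
-- count drops by Σ_{j≠i} a_ji, and the hypothesis says the two drops differ by |V_i*| - |V_*i|.
module Submission where

open import Defs
open import Data.Nat using (ℕ; zero; suc; _+_)
open import Data.Nat.Properties using (+-cancelʳ-≡; +-suc; +-commutativeSemigroup)
open import Data.Fin using (Fin; zero; suc; _≟_; _↑ˡ_; _↑ʳ_)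
open import Data.Fin.Properties using (splitAt-↑ˡ; splitAt-↑ʳ)
open import Data.Integer using (+_; _-_)
import Data.Integer as ℤ using (_+_)
import Data.Integer.Properties as ℤ using (+-injective; i-j≡0⇒i≡j; +-inverseʳ)
open import Data.Integer.Solver using () renaming (module +-*-Solver to ℤ-Solver)
open import Data.Nat.ListAction using (sum)
open import Data.List using (List; []; _∷_; _++_; _∷ʳ_; [_]; length; filter; map; concatMap; lookup; tabulate; allFin)
open import Data.List.Properties using (length-++; filter-++; filter-≐; filter-all; filter-none; map-cong; map-tabulate; tabulate-cong; tabulate-lookup; map-concatMap)
open import Data.List.NonEmpty using (List⁺; head; last; toList; snocView; _∷ʳ′_) renaming (_∷_ to _∷⁺_; _∷ʳ_ to _⁺∷ʳ_)
open import Data.List.Membership.Propositional using (_∈_)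
open import Data.List.Membership.Propositional.Properties using (∈-allFin; ∈-filter⁺; ∈-filter⁻; ∈-++⁺ˡ; ∈-++⁺ʳ)
open import Data.List.Membership.Propositional.Properties.WithK using (unique∧set⇒bag)
open import Data.List.Relation.Unary.All using (All; []; _∷_)
import Data.List.Relation.Unary.All as All
open import Data.List.Relation.Unary.All.Properties using (All¬⇒¬Any; all-filter)
import Data.List.Relation.Unary.All.Properties as All
open import Data.List.Relation.Unary.Any using (here; there)
open import Data.List.Relation.Unary.Unique.Propositional using (Unique)
open import Data.List.Relation.Unary.Unique.Propositional.Properties using (allFin⁺) renaming (filter⁺ to unique-filter⁺; ++⁺ to unique-++⁺)
open import Data.List.Relation.Unary.AllPairs using ([]; _∷_)
open import Data.List.Relation.Binary.BagAndSetEquality using (∼bag⇒↭)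
open import Data.List.Relation.Binary.Permutation.Propositional using (_↭_; ↭-refl; ↭-reflexive; ↭-trans; ↭-prep; module PermutationReasoning)
open import Data.List.Relation.Binary.Permutation.Propositional.Properties using (↭-length; filter-↭; ++⁺; ++-comm; shifts)
open import Data.Product using (_×_; _,_; proj₁; proj₂; swap)
open import Data.Sum using (inj₁; inj₂)
open import Data.Empty using (⊥-elim)
open import Function using (id; _∘_; mk⇔)
open import Algebra.Properties.CommutativeSemigroup +-commutativeSemigroup using (xy∙z≈xz∙y; x∙yz≈xz∙y)
open import Relation.Nullary using (¬_; ¬?; yes; no)
open import Relation.Nullary.Decidable using (_×-dec_; _⊎-dec_)
open import Relation.Unary using (Decidable)
open import Relation.Binary.Definitions using (DecidableEquality)
open import Relation.Binary.PropositionalEquality using (_≡_; _≢_; refl; sym; trans; cong; cong₂; module ≡-Reasoning)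

module _ {A : Set} {P Q : A → Set} (P? : Decidable P) (Q? : Decidable Q) where

  countL-× : ∀ xs → countL (λ x → P? x ×-dec Q? x) xs ≡ countL Q? (filter P? xs)
  countL-× [] = refl
  countL-× (x ∷ xs) with P? x
  ... | no _ = countL-× xs
  ... | yes _ with Q? x
  ...   | yes _ = cong suc (countL-× xs)
  ...   | no _  = countL-× xs

  countL-⊎ : (∀ x → ¬ (P x × Q x)) → ∀ xs → countL (λ x → P? x ⊎-dec Q? x) xs ≡ countL P? xs + countL Q? xs
  countL-⊎ exclusive [] = refl
  countL-⊎ exclusive (x ∷ xs) with P? x | Q? x
  ... | yes px | yes qx = ⊥-elim (exclusive x (px , qx))
  ... | yes _  | no _   = cong suc (countL-⊎ exclusive xs)
  ... | no _   | yes _  = trans (cong suc (countL-⊎ exclusive xs)) (sym (+-suc _ _))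
  ... | no _   | no _   = countL-⊎ exclusive xs

  countL-×-comm : ∀ xs → countL (λ x → P? x ×-dec Q? x) xs ≡ countL (λ x → Q? x ×-dec P? x) xs
  countL-×-comm xs = cong length (filter-≐ _ _ (swap , swap) xs)

module _ {A : Set} {P : A → Set} (P? : Decidable P) where

  countL-++ : ∀ xs ys → countL P? (xs ++ ys) ≡ countL P? xs + countL P? ys
  countL-++ xs ys = trans (cong length (filter-++ P? xs ys)) (length-++ (filter P? xs))

  countL-↭ : ∀ {xs ys} → xs ↭ ys → countL P? xs ≡ countL P? ys
  countL-↭ xs↭ys = ↭-length (filter-↭ P? xs↭ys)

  countL-map : ∀ {B : Set} (f : B → A) xs → countL P? (map f xs) ≡ countL (λ x → P? (f x)) xs
  countL-map f [] = refl
  countL-map f (x ∷ xs) with P? (f x)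
  ... | yes _ = cong suc (countL-map f xs)
  ... | no _  = countL-map f xs

module _ {A B : Set} (_≟ᴮ_ : DecidableEquality B) where

  open import Data.List.Membership.DecPropositional _≟ᴮ_ using (_∈?_)

  countL-fibres : ∀ (f : A → B) {js} → Unique js → ∀ xs →
    sum (map (λ j → countL (λ x → f x ≟ᴮ j) xs) js) ≡ countL (λ x → f x ∈? js) xs
  countL-fibres f [] xs = sym (cong length (filter-none _ (All.universal (λ _ ()) xs)))
  countL-fibres f {j ∷ js} (j∉js ∷ js!) xs = begin
    countL (λ x → f x ≟ᴮ j) xs + sum (map (λ j → countL (λ x → f x ≟ᴮ j) xs) js)
      ≡⟨ cong₂ _+_ refl (countL-fibres f js! xs) ⟩
    countL (λ x → f x ≟ᴮ j) xs + countL (λ x → f x ∈? js) xs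
      ≡⟨ countL-⊎ (λ x → f x ≟ᴮ j) (λ x → f x ∈? js) exclusive xs ⟨
    countL (λ x → (f x ≟ᴮ j) ⊎-dec (f x ∈? js)) xs
      ≡⟨ cong length (filter-≐ _ _ ((λ { (inj₁ e) → here e ; (inj₂ m) → there m })
                                  , (λ { (here e) → inj₁ e ; (there m) → inj₂ m })) xs) ⟩
    countL (λ x → f x ∈? (j ∷ js)) xs ∎
    where
    open ≡-Reasoning
    exclusive : ∀ x → ¬ (f x ≡ j × f x ∈ js)
    exclusive x (refl , m) = All¬⇒¬Any j∉js m

sumNeq-countL-× : ∀ {A : Set} {k} (f g : A → Fin k) (i : Fin k) xs → All (λ x → f x ≢ g x) xs →
  sumNeq i (λ j → countL (λ x → (f x ≟ i) ×-dec (g x ≟ j)) xs) ≡ countL (λ x → f x ≟ i) xs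
sumNeq-countL-× {k = k} f g i xs f≢g = begin
  sum (map (λ j → countL (λ x → (f x ≟ i) ×-dec (g x ≟ j)) xs) others)
    ≡⟨ cong sum (map-cong (λ j → countL-× (λ x → f x ≟ i) (λ x → g x ≟ j) xs) others) ⟩
  sum (map (λ j → countL (λ x → g x ≟ j) preimageᵢ) others)
    ≡⟨ countL-fibres _≟_ g (unique-filter⁺ _ (allFin⁺ k)) preimageᵢ ⟩
  countL (λ x → g x ∈? others) preimageᵢ
    ≡⟨ cong length (filter-all _ (All.map g∈others (All.zip (all-filter _ xs , All.filter⁺ _ f≢g)))) ⟩
  length preimageᵢ ∎
  where
  open ≡-Reasoning
  open import Data.List.Membership.DecPropositional (_≟_ {k}) using (_∈?_)
  others : List (Fin k)
  others = filter (λ j → ¬? (j ≟ i)) (allFin k)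
  preimageᵢ : List _
  preimageᵢ = filter (λ x → f x ≟ i) xs
  g∈others : ∀ {x} → f x ≡ i × f x ≢ g x → g x ∈ others
  g∈others {x} (fx≡i , fx≢gx) = ∈-filter⁺ _ (∈-allFin (g x)) (λ gx≡i → fx≢gx (trans fx≡i (sym gx≡i)))

module _ {n : ℕ} where

  open import Data.List.Membership.DecPropositional (_≟_ {n}) using (_∈?_)

  allFin-↭-∉++ : ∀ {ws : List (Fin n)} → Unique ws →
    allFin n ↭ filter (λ v → ¬? (v ∈? ws)) (allFin n) ++ ws
  allFin-↭-∉++ {ws} ws! = ∼bag⇒↭ (unique∧set⇒bag (allFin⁺ n)
    (unique-++⁺ (unique-filter⁺ _ (allFin⁺ n)) ws! apart) (λ {v} → mk⇔ to (λ _ → ∈-allFin v)))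
    where
    apart : ∀ {v} → ¬ (v ∈ filter (λ v → ¬? (v ∈? ws)) (allFin n) × v ∈ ws)
    apart (v∈rest , v∈ws) = proj₂ (∈-filter⁻ (λ v → ¬? (v ∈? ws)) {xs = allFin n} v∈rest) v∈ws
    to : ∀ {v} → v ∈ allFin n → v ∈ filter (λ v → ¬? (v ∈? ws)) (allFin n) ++ ws
    to {v} _ with v ∈? ws
    ... | yes v∈ws = ∈-++⁺ʳ _ v∈ws
    ... | no v∉ws  = ∈-++⁺ˡ (∈-filter⁺ _ (∈-allFin v) v∉ws)

tabulate-↑ : ∀ {A : Set} m {n} (h : Fin (m + n) → A) →
  tabulate h ≡ tabulate (λ w → h (w ↑ˡ n)) ++ tabulate (λ q → h (m ↑ʳ q))
tabulate-↑ zero    h = refl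
tabulate-↑ (suc m) h = cong (h zero ∷_) (tabulate-↑ m (λ j → h (suc j)))

module _ {A : Set} where

  map-proj₂-pairs : ∀ (x : A) xs → map proj₂ (pairs (x ∷ xs)) ≡ xs
  map-proj₂-pairs x []       = refl
  map-proj₂-pairs x (y ∷ ys) = cong (y ∷_) (map-proj₂-pairs y ys)

  map-proj₁-pairs-∷ʳ : ∀ xs (y : A) → map proj₁ (pairs (xs ∷ʳ y)) ≡ xs
  map-proj₁-pairs-∷ʳ []            y = refl
  map-proj₁-pairs-∷ʳ (x ∷ [])      y = refl
  map-proj₁-pairs-∷ʳ (x ∷ x′ ∷ xs) y = cong (x ∷_) (map-proj₁-pairs-∷ʳ (x′ ∷ xs) y)

  toList-∷ʳ : ∀ xs (y : A) → toList (xs ⁺∷ʳ y) ≡ xs ∷ʳ y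
  toList-∷ʳ []       y = refl
  toList-∷ʳ (x ∷ xs) y = refl

  toList-↭-head∷targets : ∀ (P : List⁺ A) → toList P ↭ head P ∷ map proj₂ (pairs (toList P))
  toList-↭-head∷targets (x ∷⁺ xs) = ↭-reflexive (cong (x ∷_) (sym (map-proj₂-pairs x xs)))

  toList-↭-last∷sources : ∀ (P : List⁺ A) → toList P ↭ last P ∷ map proj₁ (pairs (toList P))
  toList-↭-last∷sources P with snocView P
  ... | xs ∷ʳ′ y = begin
    toList (xs ⁺∷ʳ y)                       ≡⟨ toList-∷ʳ xs y ⟩
    xs ∷ʳ y                                 ↭⟨ ++-comm xs [ y ] ⟩
    y ∷ xs                                  ≡⟨ cong (y ∷_) (map-proj₁-pairs-∷ʳ xs y) ⟨
    y ∷ map proj₁ (pairs (xs ∷ʳ y))         ≡⟨ cong (λ zs → y ∷ map proj₁ (pairs zs)) (toList-∷ʳ xs y) ⟨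
    y ∷ map proj₁ (pairs (toList (xs ⁺∷ʳ y))) ∎
    where open PermutationReasoning

module _ {A B : Set} {f : A → List B} (e : A → B) (s : A → List B) (f↭e∷s : ∀ x → f x ↭ e x ∷ s x) where

  concatMap-↭ : ∀ xs → concatMap f xs ↭ map e xs ++ concatMap s xs
  concatMap-↭ []       = ↭-refl
  concatMap-↭ (x ∷ xs) = ↭-trans (++⁺ (f↭e∷s x) (concatMap-↭ xs)) (↭-prep (e x) (shifts (s x) (map e xs)))

module _ {n : ℕ} (Qs : List (List⁺ (Fin n))) where

  vertsOf-↭-heads++targets : vertsOf Qs ↭ map head Qs ++ map proj₂ (edgesOf Qs)
  vertsOf-↭-heads++targets =
    ↭-trans (concatMap-↭ head (λ P → map proj₂ (pairs (toList P))) toList-↭-head∷targets Qs)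
            (↭-reflexive (cong (map head Qs ++_) (sym (map-concatMap proj₂ (λ P → pairs (toList P)) Qs))))

  vertsOf-↭-lasts++sources : vertsOf Qs ↭ map last Qs ++ map proj₁ (edgesOf Qs)
  vertsOf-↭-lasts++sources =
    ↭-trans (concatMap-↭ last (λ P → map proj₁ (pairs (toList P))) toList-↭-last∷sources Qs)
            (↭-reflexive (cong (map last Qs ++_) (sym (map-concatMap proj₁ (λ P → pairs (toList P)) Qs))))

  module _ {P : Fin n → Set} (P? : Decidable P) where

    countL-vertsOf-heads : countL P? (vertsOf Qs) ≡ countL (λ Q → P? (head Q)) Qs + countL (λ e → P? (proj₂ e)) (edgesOf Qs)
    countL-vertsOf-heads = trans (countL-↭ P? vertsOf-↭-heads++targets)
      (trans (countL-++ P? (map head Qs) _) (cong₂ _+_ (countL-map P? head Qs) (countL-map P? proj₂ (edgesOf Qs))))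

    countL-vertsOf-lasts : countL P? (vertsOf Qs) ≡ countL (λ Q → P? (last Q)) Qs + countL (λ e → P? (proj₁ e)) (edgesOf Qs)
    countL-vertsOf-lasts = trans (countL-↭ P? vertsOf-↭-lasts++sources)
      (trans (countL-++ P? (map last Qs) _) (cong₂ _+_ (countL-map P? last Qs) (countL-map P? proj₁ (edgesOf Qs))))

module _ {k : ℕ} (G : Digraph) (part : Partition k (n G)) (Qs : List (List⁺ (Fin (n G)))) where

  open Contraction G part Qs

  contractedPart : List⁺ (Fin (n G)) → Fin k × Fin k
  contractedPart P = proj₁ (part (last P)) , proj₂ (part (head P))

  map-part'-allFin : map part' (allFin (u + p)) ≡ map part untouched ++ map contractedPart Qs
  map-part'-allFin = begin
    map part' (allFin (u + p))
      ≡⟨ map-tabulate id part' ⟩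
    tabulate part'
      ≡⟨ tabulate-↑ u part' ⟩
    tabulate (λ w → part' (w ↑ˡ p)) ++ tabulate (λ q → part' (u ↑ʳ q))
      ≡⟨ cong₂ _++_ (tabulate-cong part'-↑ˡ) (tabulate-cong part'-↑ʳ) ⟩
    tabulate (λ w → part (lookup untouched w)) ++ tabulate (λ q → contractedPart (lookup Qs q))
      ≡⟨ cong₂ _++_ (map-tabulate (lookup untouched) part) (map-tabulate (lookup Qs) contractedPart) ⟨
    map part (tabulate (lookup untouched)) ++ map contractedPart (tabulate (lookup Qs))
      ≡⟨ cong₂ _++_ (cong (map part) (tabulate-lookup untouched)) (cong (map contractedPart) (tabulate-lookup Qs)) ⟩
    map part untouched ++ map contractedPart Qs ∎
    where
    open ≡-Reasoning
    part'-↑ˡ : ∀ w → part' (w ↑ˡ p) ≡ part (lookup untouched w)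
    part'-↑ˡ w rewrite splitAt-↑ˡ u w p = refl
    part'-↑ʳ : ∀ q → part' (u ↑ʳ q) ≡ contractedPart (lookup Qs q)
    part'-↑ʳ q rewrite splitAt-↑ʳ u p q = refl

  countL-contraction : ∀ {P : Fin k × Fin k → Set} (P? : Decidable P) → Unique (vertsOf Qs) →
    countL (λ v → P? (part v)) (allFin (n G)) + countL (λ Q → P? (contractedPart Q)) Qs
      ≡ countL (λ x → P? (part' x)) (allFin (u + p)) + countL (λ v → P? (part v)) (vertsOf Qs)
  countL-contraction {P} P? W! = begin
    countL inPart (allFin (n G)) + #paths
      ≡⟨ cong₂ _+_ (trans (countL-↭ inPart (allFin-↭-∉++ W!)) (countL-++ inPart untouched (vertsOf Qs))) refl ⟩
    (#untouched + #removed) + #paths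
      ≡⟨ xy∙z≈xz∙y #untouched #removed #paths ⟩
    (#untouched + #paths) + #removed
      ≡⟨ cong₂ _+_ #new refl ⟨
    countL (λ x → P? (part' x)) (allFin (u + p)) + #removed ∎
    where
    open ≡-Reasoning
    inPart : Decidable (λ v → P (part v))
    inPart v = P? (part v)
    #untouched #removed #paths : ℕ
    #untouched = countL inPart untouched
    #removed   = countL inPart (vertsOf Qs)
    #paths     = countL (λ Q → P? (contractedPart Q)) Qs
    #new : countL (λ x → P? (part' x)) (allFin (u + p)) ≡ #untouched + #paths
    #new = begin
      countL (λ x → P? (part' x)) (allFin (u + p))
        ≡⟨ countL-map P? part' (allFin (u + p)) ⟨
      countL P? (map part' (allFin (u + p)))
        ≡⟨ cong (countL P?) map-part'-allFin ⟩
      countL P? (map part untouched ++ map contractedPart Qs)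
        ≡⟨ countL-++ P? (map part untouched) (map contractedPart Qs) ⟩
      countL P? (map part untouched) + countL P? (map contractedPart Qs)
        ≡⟨ cong₂ _+_ (countL-map P? part untouched) (countL-map P? contractedPart Qs) ⟩
      #untouched + #paths ∎

  module _ (W! : Unique (vertsOf Qs)) (i : Fin k) where

    rowSize-contraction : rowSize part i ≡ rowSize part' i + countL (λ e → proj₁ (part (proj₁ e)) ≟ i) (edgesOf Qs)
    rowSize-contraction = +-cancelʳ-≡ #lasts _ _ (begin
      rowSize part i + #lasts
        ≡⟨ countL-contraction (λ z → proj₁ z ≟ i) W! ⟩
      rowSize part' i + countL (λ v → proj₁ (part v) ≟ i) (vertsOf Qs)
        ≡⟨ cong₂ _+_ refl (countL-vertsOf-lasts Qs (λ v → proj₁ (part v) ≟ i)) ⟩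
      rowSize part' i + (#lasts + #sources)
        ≡⟨ x∙yz≈xz∙y (rowSize part' i) #lasts #sources ⟩
      (rowSize part' i + #sources) + #lasts ∎)
      where
      open ≡-Reasoning
      #lasts #sources : ℕ
      #lasts   = countL (λ Q → proj₁ (part (last Q)) ≟ i) Qs
      #sources = countL (λ e → proj₁ (part (proj₁ e)) ≟ i) (edgesOf Qs)

    colSize-contraction : colSize part i ≡ colSize part' i + countL (λ e → proj₂ (part (proj₂ e)) ≟ i) (edgesOf Qs)
    colSize-contraction = +-cancelʳ-≡ #heads _ _ (begin
      colSize part i + #heads
        ≡⟨ countL-contraction (λ z → proj₂ z ≟ i) W! ⟩
      colSize part' i + countL (λ v → proj₂ (part v) ≟ i) (vertsOf Qs)
        ≡⟨ cong₂ _+_ refl (countL-vertsOf-heads Qs (λ v → proj₂ (part v) ≟ i)) ⟩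
      colSize part' i + (#heads + #targets)
        ≡⟨ x∙yz≈xz∙y (colSize part' i) #heads #targets ⟩
      (colSize part' i + #targets) + #heads ∎)
      where
      open ≡-Reasoning
      #heads #targets : ℕ
      #heads   = countL (λ Q → proj₂ (part (head Q)) ≟ i) Qs
      #targets = countL (λ e → proj₂ (part (proj₂ e)) ≟ i) (edgesOf Qs)

module _ {k N : ℕ} (part : Partition k N) (Qs : List (List⁺ (Fin N))) (inB : All (InB part) (edgesOf Qs)) (i : Fin k) where

  private
    row≢col : All (λ e → proj₁ (part (proj₁ e)) ≢ proj₂ (part (proj₂ e))) (edgesOf Qs)
    row≢col = All.map (λ { {_ , _} ne → ne }) inB

  sumNeq-aCount-out : sumNeq i (λ j → aCount part Qs i j) ≡ countL (λ e → proj₁ (part (proj₁ e)) ≟ i) (edgesOf Qs)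
  sumNeq-aCount-out = sumNeq-countL-× (λ e → proj₁ (part (proj₁ e))) (λ e → proj₂ (part (proj₂ e))) i (edgesOf Qs) row≢col

  sumNeq-aCount-in : sumNeq i (λ j → aCount part Qs j i) ≡ countL (λ e → proj₂ (part (proj₂ e)) ≟ i) (edgesOf Qs)
  sumNeq-aCount-in = trans (cong sum (map-cong swap-factors (filter (λ j → ¬? (j ≟ i)) (allFin k))))
    (sumNeq-countL-× (λ e → proj₂ (part (proj₂ e))) (λ e → proj₁ (part (proj₁ e))) i (edgesOf Qs) (All.map (_∘ sym) row≢col))
    where
    swap-factors : ∀ j → aCount part Qs j i
                       ≡ countL (λ e → (proj₂ (part (proj₂ e)) ≟ i) ×-dec (proj₁ (part (proj₁ e)) ≟ j)) (edgesOf Qs)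
    swap-factors j = countL-×-comm (λ e → proj₁ (part (proj₁ e)) ≟ j) (λ e → proj₂ (part (proj₂ e)) ≟ i) (edgesOf Qs)

+-differences-cancel : ∀ r c a b → + a - + b ≡ + (r + a) - + (c + b) → r ≡ c
+-differences-cancel r c a b eq = ℤ.+-injective (ℤ.i-j≡0⇒i≡j (+ r) (+ c) (begin
  + r - + c                                   ≡⟨ regroup (+ r) (+ c) (+ a) (+ b) ⟩
  (+ (r + a) - + (c + b)) - (+ a - + b)       ≡⟨ cong (_- (+ a - + b)) eq ⟨
  (+ a - + b) - (+ a - + b)                   ≡⟨ ℤ.+-inverseʳ (+ a - + b) ⟩
  + 0 ∎))
  where
  open ≡-Reasoning
  open ℤ-Solver using (solve; _:+_; _:-_; _:=_)
  regroup : ∀ r c a b → r - c ≡ ((r ℤ.+ a) - (c ℤ.+ b)) - (a - b)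
  regroup = solve 4 (λ r c a b → r :- c := ((r :+ a) :- (c :+ b)) :- (a :- b)) refl

lemma4p10 : (k : ℕ) (G : Digraph) (part : Partition k (n G)) (Q : PathSystem G) →
  All (InB part) (edgesOf (paths Q)) →
  (∀ i → (+ sumNeq i (λ j → aCount part (paths Q) i j)) - (+ sumNeq i (λ j → aCount part (paths Q) j i))
           ≡ (+ rowSize part i) - (+ colSize part i)) →
  ∀ (i : Fin k) → rowSize (Contraction.part' G part (paths Q)) i ≡ colSize (Contraction.part' G part (paths Q)) i
lemma4p10 k G part Q inB balanced i = +-differences-cancel _ _ _ _ (begin
  + #sources - + #targets
    ≡⟨ cong₂ (λ a b → + a - + b) (sumNeq-aCount-out part Qs inB i) (sumNeq-aCount-in part Qs inB i) ⟨
  + sumNeq i (λ j → aCount part Qs i j) - + sumNeq i (λ j → aCount part Qs j i)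
    ≡⟨ balanced i ⟩
  + rowSize part i - + colSize part i
    ≡⟨ cong₂ (λ r c → + r - + c) (rowSize-contraction G part Qs (disjoint Q) i) (colSize-contraction G part Qs (disjoint Q) i) ⟩
  + (rowSize part' i + #sources) - + (colSize part' i + #targets) ∎)
  where
  open ≡-Reasoning
  Qs : List (List⁺ (Fin (n G)))
  Qs = paths Q
  open Contraction G part Qs using (part')
  #sources #targets : ℕ
  #sources = countL (λ e → proj₁ (part (proj₁ e)) ≟ i) (edgesOf Qs)
  #targets = countL (λ e → proj₂ (part (proj₂ e)) ≟ i) (edgesOf Qs)
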